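{- Let $G$ be a finite simple graph of order $n$. Then $\chi_{md}(G)=n$ if and only if $G=K_n$.
   Context: For a vertex $v$, $N[v]=N(v)\cup\{v\}$; $v$ dominates exactly the vertices of $N[v]$. A majority dominator coloring of $G$ is a proper vertex coloring such that for every vertex $v$ there is a color class $C$ with $|N[v]\cap C|\geq |C|/2$. $\chi_{md}(G)$ is the minimum number of color classes in a majority dominator coloring of $G$. -}

module Defs where

open import Data.Nat using (ℕ; _≤_; _*_)
open import Data.Fin using (Fin)
open import Data.Fin.Properties using () renaming (_≟_ to _≟ᶠ_)
open import Data.List using (List; length; filter)
open import Data.List.Base using ()
open import Data.Fin.Base using ()
open import Data.List using () renaming (allFin to allFinL)
open import Data.Product using (Σ; ∃; _×_)
open import Data.Sum using (_⊎_)
open import Relation.Nullary using (¬_; Dec)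
open import Relation.Nullary.Decidable using (_×-dec_; _⊎-dec_)
open import Relation.Binary.PropositionalEquality using (_≡_)
open import Function using (Surjective)

record Graph (n : ℕ) : Set₁ where
  field
    Adj     : Fin n → Fin n → Set
    adj?    : ∀ u v → Dec (Adj u v)
    sym     : ∀ {u v} → Adj u v → Adj v u
    irrefl  : ∀ {u} → ¬ Adj u u

open Graph public

InClosedNbhd : ∀ {n} → Graph n → Fin n → Fin n → Set
InClosedNbhd G v w = (w ≡ v) ⊎ Adj G v w

inClosedNbhd? : ∀ {n} (G : Graph n) v w → Dec (InClosedNbhd G v w)
inClosedNbhd? G v w = (w ≟ᶠ v) ⊎-dec adj? G v w

classSize : ∀ {n k} → (Fin n → Fin k) → Fin k → ℕ
classSize c i = length (filter (λ w → c w ≟ᶠ i) (allFinL _))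

nbhdClassSize : ∀ {n k} → Graph n → (Fin n → Fin k) → Fin n → Fin k → ℕ
nbhdClassSize G c v i =
  length (filter (λ w → inClosedNbhd? G v w ×-dec (c w ≟ᶠ i)) (allFinL _))

Proper : ∀ {n k} → Graph n → (Fin n → Fin k) → Set
Proper G c = ∀ u v → Adj G u v → ¬ (c u ≡ c v)

-- A majority dominator coloring with exactly k color classes:
-- c : V → Fin k is proper and surjective (so all k classes are non-empty),
-- and every vertex v has a class C with |N[v] ∩ C| ≥ |C|/2.
IsMDColoring : ∀ {n k} → Graph n → (Fin n → Fin k) → Set
IsMDColoring {n} {k} G c =
  Proper G c × Surjective _≡_ _≡_ c
  × (∀ v → ∃ λ (i : Fin k) → classSize c i ≤ 2 * nbhdClassSize G c v i)

HasMDColoring : ∀ {n} → Graph n → ℕ → Set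
HasMDColoring {n} G k = Σ (Fin n → Fin k) (IsMDColoring G)

ChiMDEq : ∀ {n} → Graph n → ℕ → Set
ChiMDEq G m = HasMDColoring G m × (∀ k → HasMDColoring G k → m ≤ k)

IsComplete : ∀ {n} → Graph n → Set
IsComplete {n} G = ∀ (u v : Fin n) → ¬ (u ≡ v) → Adj G u v

-- A colouring all of whose classes have at most two vertices is majority
-- dominating, since each vertex already dominates half of its own class.
-- The identity colouring of K_n is therefore an MD colouring, and every proper
-- colouring of K_n is injective, so χ_md(K_n) = n.  Conversely, if u and v are
-- distinct non-adjacent vertices, giving v the colour of u and the remaining
-- vertices distinct colours is an MD colouring with n - 1 classes.
module Submission where

open import Defs
open import Data.Nat using (ℕ; suc; _≤_; _*_; z≤n; s≤s)
open import Data.Nat.Properties using (≤-trans; *-monoʳ-≤; 1+n≰n)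
open import Data.Fin using (Fin; punchIn; punchOut)
open import Data.Fin.Properties
  using (injective⇒≤; punchInᵢ≢i; punchIn-punchOut; punchOut-punchIn; punchOut-cong; punchOut-injective)
  renaming (_≟_ to _≟ᶠ_)
open import Data.List using (List; []; _∷_; length; filter) renaming (allFin to allFinL)
open import Data.List.Properties using (filter-some)
open import Data.List.Relation.Unary.All as All using (All; _∷_)
open import Data.List.Relation.Unary.All.Properties using (all-filter)
open import Data.List.Relation.Unary.AllPairs using (_∷_)
open import Data.List.Relation.Unary.Unique.Propositional using (Unique)
open import Data.List.Relation.Unary.Unique.Propositional.Properties using (allFin⁺; filter⁺)
open import Data.List.Membership.Propositional using (lose)
open import Data.List.Membership.Propositional.Properties using (∈-allFin)
open import Data.Product using (_×_; _,_; ∃)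
open import Data.Sum using (_⊎_; inj₁; inj₂)
open import Data.Empty using (⊥-elim)
open import Function using (id; _∘_; Injective; Surjective)
open import Relation.Nullary using (¬_; yes; no)
open import Relation.Nullary.Decidable using (_×-dec_)
open import Relation.Binary.PropositionalEquality using (_≡_; _≢_; refl; trans) renaming (sym to ≡-sym)

two-of-three-in-pair : ∀ {A : Set} {a b x y z : A} →
  x ≡ a ⊎ x ≡ b → y ≡ a ⊎ y ≡ b → z ≡ a ⊎ z ≡ b → x ≡ y ⊎ x ≡ z ⊎ y ≡ z
two-of-three-in-pair (inj₁ refl) (inj₁ refl) _           = inj₁ refl
two-of-three-in-pair (inj₂ refl) (inj₂ refl) _           = inj₁ refl
two-of-three-in-pair (inj₁ refl) (inj₂ refl) (inj₁ refl) = inj₂ (inj₁ refl)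
two-of-three-in-pair (inj₂ refl) (inj₁ refl) (inj₂ refl) = inj₂ (inj₁ refl)
two-of-three-in-pair (inj₁ refl) (inj₂ refl) (inj₂ refl) = inj₂ (inj₂ refl)
two-of-three-in-pair (inj₂ refl) (inj₁ refl) (inj₁ refl) = inj₂ (inj₂ refl)

unique-within-pair⇒length≤2 : ∀ {A : Set} {a b : A} {xs : List A} →
  Unique xs → All (λ x → x ≡ a ⊎ x ≡ b) xs → length xs ≤ 2
unique-within-pair⇒length≤2 {xs = []}           _ _ = z≤n
unique-within-pair⇒length≤2 {xs = _ ∷ []}       _ _ = s≤s z≤n
unique-within-pair⇒length≤2 {xs = _ ∷ _ ∷ []}   _ _ = s≤s (s≤s z≤n)
unique-within-pair⇒length≤2 {xs = _ ∷ _ ∷ _ ∷ _}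
  ((x≢y ∷ x≢z ∷ _) ∷ (y≢z ∷ _) ∷ _) (px ∷ py ∷ pz ∷ _)
  with two-of-three-in-pair px py pz
... | inj₁ x≡y        = ⊥-elim (x≢y x≡y)
... | inj₂ (inj₁ x≡z) = ⊥-elim (x≢z x≡z)
... | inj₂ (inj₂ y≡z) = ⊥-elim (y≢z y≡z)

module _ {n k : ℕ} (c : Fin n → Fin k) where

  classSize≤2 : ∀ (i : Fin k) {a b : Fin n} →
    (∀ w → c w ≡ i → w ≡ a ⊎ w ≡ b) → classSize c i ≤ 2
  classSize≤2 i within = unique-within-pair⇒length≤2
    (filter⁺ (λ w → c w ≟ᶠ i) (allFin⁺ n))
    (All.map (within _) (all-filter (λ w → c w ≟ᶠ i) (allFinL n)))

  nbhdClassSize-own-positive : ∀ (G : Graph n) v → 1 ≤ nbhdClassSize G c v (c v)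
  nbhdClassSize-own-positive G v =
    filter-some (λ w → inClosedNbhd? G v w ×-dec (c w ≟ᶠ c v)) (lose (∈-allFin v) (inj₁ refl , refl))

  classes≤2⇒isMDColoring : ∀ (G : Graph n) → Proper G c → Surjective _≡_ _≡_ c →
    (∀ i → classSize c i ≤ 2) → IsMDColoring G c
  classes≤2⇒isMDColoring G proper surjective small = proper , surjective , majority
    where
    majority : ∀ v → ∃ λ i → classSize c i ≤ 2 * nbhdClassSize G c v i
    majority v = c v , ≤-trans (small (c v)) (*-monoʳ-≤ 2 (nbhdClassSize-own-positive G v))

module _ {n : ℕ} (G : Graph n) where

  id-isMDColoring : IsMDColoring G id
  id-isMDColoring = classes≤2⇒isMDColoring id G proper (λ i → i , id)
    (λ i → classSize≤2 id i {b = i} (λ _ → inj₁))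
    where
    proper : Proper G id
    proper u v adj refl = irrefl G adj

  complete∧proper⇒injective : IsComplete G → ∀ {k} {c : Fin n → Fin k} →
    Proper G c → Injective _≡_ _≡_ c
  complete∧proper⇒injective complete proper {x} {y} cx≡cy with x ≟ᶠ y
  ... | yes x≡y = x≡y
  ... | no  x≢y = ⊥-elim (proper x y (complete x y x≢y) cx≡cy)

  complete⇒chiMD≡n : IsComplete G → ChiMDEq G n
  complete⇒chiMD≡n complete = (id , id-isMDColoring) , minimal
    where
    minimal : ∀ k → HasMDColoring G k → n ≤ k
    minimal k (c , proper , _) = injective⇒≤ {f = c} (complete∧proper⇒injective complete proper)

module Merge {m : ℕ} {u v : Fin (suc m)} (u≢v : u ≢ v) where

  -- v gets the colour of u; the other vertices get pairwise distinct colours.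
  merge : Fin (suc m) → Fin m
  merge w with w ≟ᶠ v
  ... | yes _   = punchOut (u≢v ∘ ≡-sym)
  ... | no  w≢v = punchOut (w≢v ∘ ≡-sym)

  merge-surjective : Surjective _≡_ _≡_ merge
  merge-surjective j = punchIn v j , λ { refl → merge-punchIn }
    where
    merge-punchIn : merge (punchIn v j) ≡ j
    merge-punchIn with punchIn v j ≟ᶠ v
    ... | yes punchIn≡v = ⊥-elim (punchInᵢ≢i v j punchIn≡v)
    ... | no  _         = trans (punchOut-cong v refl) (punchOut-punchIn v)

  merge-fiber : ∀ {i} w → merge w ≡ i → w ≡ v ⊎ w ≡ punchIn v i
  merge-fiber w refl with w ≟ᶠ v
  ... | yes w≡v = inj₁ w≡v
  ... | no  w≢v = inj₂ (≡-sym (punchIn-punchOut (w≢v ∘ ≡-sym)))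

  merge-collision : ∀ x y → merge x ≡ merge y → x ≡ y ⊎ (x ≡ v × y ≡ u) ⊎ (x ≡ u × y ≡ v)
  merge-collision x y e with x ≟ᶠ v | y ≟ᶠ v
  ... | yes x≡v | yes y≡v = inj₁ (trans x≡v (≡-sym y≡v))
  ... | yes x≡v | no  y≢v = inj₂ (inj₁ (x≡v , ≡-sym (punchOut-injective (u≢v ∘ ≡-sym) (y≢v ∘ ≡-sym) e)))
  ... | no  x≢v | yes y≡v = inj₂ (inj₂ (punchOut-injective (x≢v ∘ ≡-sym) (u≢v ∘ ≡-sym) e , y≡v))
  ... | no  x≢v | no  y≢v = inj₁ (punchOut-injective (x≢v ∘ ≡-sym) (y≢v ∘ ≡-sym) e)

  merge-proper : (G : Graph (suc m)) → ¬ Adj G u v → Proper G merge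
  merge-proper G ¬adj x y adj e with merge-collision x y e
  ... | inj₁ refl                 = irrefl G adj
  ... | inj₂ (inj₁ (refl , refl)) = ¬adj (Graph.sym G adj)
  ... | inj₂ (inj₂ (refl , refl)) = ¬adj adj

  merge-isMDColoring : (G : Graph (suc m)) → ¬ Adj G u v → IsMDColoring G merge
  merge-isMDColoring G ¬adj = classes≤2⇒isMDColoring merge G (merge-proper G ¬adj) merge-surjective
    (λ i → classSize≤2 merge i merge-fiber)

chiMD≡n⇒complete : ∀ {n} (G : Graph n) → ChiMDEq G n → IsComplete G
chiMD≡n⇒complete {suc m} G (_ , minimal) u v u≢v with adj? G u v
... | yes adj = adj
... | no ¬adj = ⊥-elim (1+n≰n (minimal m (merge , merge-isMDColoring G ¬adj)))
  where open Merge u≢v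

proposition2p11 : (n : ℕ) (G : Graph n) →
    (ChiMDEq G n → IsComplete G) × (IsComplete G → ChiMDEq G n)
proposition2p11 n G = chiMD≡n⇒complete G , complete⇒chiMD≡n G
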